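{- For every CF program $\mathtt{p}$ there is a polynomial $\pi$ such that $\#\mathit{Reach}_{\mathtt{p}}(x)\le\pi(|x|)$ for all $x\in\{0,1\}^*$.
   Context: CF is a first-order, call-by-value functional language with no data constructors. A CF program is a finite sequence of function definitions $\mathtt{f\ x1 \ldots xm = e}$; the first definition $\mathtt{f_1\ x = e}$ is the entry function. Expressions are $\mathtt{True}$, $\mathtt{False}$, $\mathtt{[\,]}$, variables, $\mathtt{not\ e}$, $\mathtt{null\ e}$, $\mathtt{head\ e}$, $\mathtt{tail\ e}$, $\mathtt{if\ e\ then\ e\ else\ e}$, and calls $\mathtt{f\ e1\ldots em}$. Values are bits or bit lists. The semantics is given by big-step rules $\mathtt{p},\rho\vdash\mathtt{e}\to v$ with environments $\rho$. A call to $\mathtt{f}$ evaluates its arguments and then the body $\mathtt{e}^{\mathtt{f}}$ of $\mathtt{f}$ in an environment $\rho$ binding the parameters to the argument values. $\mathit{Reach}_{\mathtt{p}}(x)$ is the set of pairs $(\mathtt{f},\rho)$ such that the body $\mathtt{e}^{\mathtt{f}}$ is called at least once with environment $\rho$ while computing $[\![\mathtt{p}]\!](x)$. -}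

module Defs where

open import Data.Bool using (Bool; true; false)
open import Data.Nat using (ℕ; zero; suc; _+_; _*_)
open import Data.Fin using (Fin; zero; suc)
open import Data.List using (List; []; _∷_; length)
open import Data.Vec using (Vec; []; _∷_; lookup)
open import Data.Product using (Σ; _,_)
open import Data.Sum using (_⊎_)
open import Data.List.Relation.Unary.All using (All)
open import Data.List.Relation.Unary.Unique.Propositional using (Unique)
open import Relation.Binary.PropositionalEquality using (_≡_)

data Val : Set where
  bit : Bool → Val
  lst : List Bool → Val

-- CF expressions.  n = number of functions of the program,
-- ar = arities of the functions, m = number of variables in scope
-- (variables are de Bruijn indices into the parameters of the
-- enclosing function).

data Expr (n : ℕ) (ar : Fin n → ℕ) (m : ℕ) : Set where
  eTrue eFalse eNil : Expr n ar m
  eVar  : Fin m → Expr n ar m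
  eNot eNull eHead eTail : Expr n ar m → Expr n ar m
  eIf   : Expr n ar m → Expr n ar m → Expr n ar m → Expr n ar m
  eCall : (g : Fin n) → Vec (Expr n ar m) (ar g) → Expr n ar m

arityOf : ∀ {k} → Vec ℕ k → Fin (suc k) → ℕ
arityOf as zero    = 1
arityOf as (suc i) = lookup as i

-- A CF program: a nonempty finite sequence of function definitions,
-- the first one (index zero) being the entry function  f1 x = e.
record Program : Set where
  field
    k        : ℕ
    arities  : Vec ℕ k
    body     : (f : Fin (suc k)) → Expr (suc k) (arityOf arities) (arityOf arities f)

  Fun : Set
  Fun = Fin (suc k)

  ar : Fun → ℕ
  ar = arityOf arities

  Env : ℕ → Set
  Env m = Vec Val m

  E : ℕ → Set
  E m = Expr (suc k) ar m

  Call : Set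
  Call = Σ Fun (λ f → Env (ar f))

open Program public

module _ (p : Program) where

  mutual
    data Eval {m : ℕ} (ρ : Env p m) : E p m → Val → Set where
      ev-true  : Eval ρ eTrue (bit true)
      ev-false : Eval ρ eFalse (bit false)
      ev-nil   : Eval ρ eNil (lst [])
      ev-var   : ∀ i → Eval ρ (eVar i) (lookup ρ i)
      ev-not   : ∀ {e b} → Eval ρ e (bit b) → Eval ρ (eNot e) (bit (Data.Bool.not b))
      ev-null-nil  : ∀ {e} → Eval ρ e (lst []) → Eval ρ (eNull e) (bit true)
      ev-null-cons : ∀ {e b bs} → Eval ρ e (lst (b ∷ bs)) → Eval ρ (eNull e) (bit false)
      ev-head  : ∀ {e b bs} → Eval ρ e (lst (b ∷ bs)) → Eval ρ (eHead e) (bit b)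
      ev-tail  : ∀ {e b bs} → Eval ρ e (lst (b ∷ bs)) → Eval ρ (eTail e) (lst bs)
      ev-if-true  : ∀ {e0 e1 e2 v} → Eval ρ e0 (bit true)  → Eval ρ e1 v → Eval ρ (eIf e0 e1 e2) v
      ev-if-false : ∀ {e0 e1 e2 v} → Eval ρ e0 (bit false) → Eval ρ e2 v → Eval ρ (eIf e0 e1 e2) v
      ev-call  : ∀ {g args vs v} → EvalArgs ρ args vs → Eval vs (body p g) v →
                 Eval ρ (eCall g args) v

    data EvalArgs {m : ℕ} (ρ : Env p m) : ∀ {j} → Vec (E p m) j → Vec Val j → Set where
      ea-[] : EvalArgs ρ [] []
      ea-∷  : ∀ {j e v} {es : Vec (E p m) j} {vs} →
              Eval ρ e v → EvalArgs ρ es vs → EvalArgs ρ (e ∷ es) (v ∷ vs)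

  -- Calls ρ e (f , σ): while evaluating e in environment ρ, the body
  -- of f is called (at least once) with environment σ.  Arguments are
  -- evaluated left to right (call by value).
  mutual
    data Calls {m : ℕ} (ρ : Env p m) : E p m → Call p → Set where
      c-not  : ∀ {e c} → Calls ρ e c → Calls ρ (eNot e) c
      c-null : ∀ {e c} → Calls ρ e c → Calls ρ (eNull e) c
      c-head : ∀ {e c} → Calls ρ e c → Calls ρ (eHead e) c
      c-tail : ∀ {e c} → Calls ρ e c → Calls ρ (eTail e) c
      c-if0  : ∀ {e0 e1 e2 c} → Calls ρ e0 c → Calls ρ (eIf e0 e1 e2) c
      c-if1  : ∀ {e0 e1 e2 c} → Eval ρ e0 (bit true)  → Calls ρ e1 c → Calls ρ (eIf e0 e1 e2) c
      c-if2  : ∀ {e0 e1 e2 c} → Eval ρ e0 (bit false) → Calls ρ e2 c → Calls ρ (eIf e0 e1 e2) c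
      c-args : ∀ {g args c} → CallsArgs ρ args c → Calls ρ (eCall g args) c
      c-call : ∀ {g args vs} → EvalArgs ρ args vs → Calls ρ (eCall g args) (g , vs)
      c-body : ∀ {g args vs c} → EvalArgs ρ args vs → Calls vs (body p g) c →
               Calls ρ (eCall g args) c

    data CallsArgs {m : ℕ} (ρ : Env p m) : ∀ {j} → Vec (E p m) j → Call p → Set where
      ca-here  : ∀ {j e c} {es : Vec (E p m) j} → Calls ρ e c → CallsArgs ρ (e ∷ es) c
      ca-there : ∀ {j e v c} {es : Vec (E p m) j} → Eval ρ e v → CallsArgs ρ es c →
                 CallsArgs ρ (e ∷ es) c

  Reach : List Bool → Call p → Set
  Reach x c = (c ≡ (zero , (lst x ∷ []))) ⊎ Calls (lst x ∷ []) (body p zero) c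

  CardReach≤ : List Bool → ℕ → Set
  CardReach≤ x N = (cs : List (Call p)) → Unique cs → All (Reach x) cs → length cs ≤ N
    where open Data.Nat using (_≤_)

-- Polynomials with natural-number coefficients (constant term first).

evalPoly : List ℕ → ℕ → ℕ
evalPoly []       n = 0
evalPoly (a ∷ as) n = a + n * evalPoly as n

module Submission where

-- Since CF has no data constructors, evaluation never builds new lists:
-- every value arising while computing [[p]](x) is a bit or a suffix of
-- the input x.  There are only  3 + |x|  such "admissible" values
-- (two bits and the |x| + 1 suffixes), so a function f of arity a can
-- be called with at most (3 + |x|)^a distinct environments.  Hence
--   # Reach_p(x)  ≤  Σ_f (3 + |x|)^(arity f),
-- a polynomial in |x| whose shape depends only on p.

open import Defs
open import Function using (_∘_)
open import Data.Bool using (Bool; true; false)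
open import Data.Nat using (ℕ; zero; suc; _+_; _*_; _^_; _≤_; z≤n; s≤s)
open import Data.Nat.Properties using (≤-trans; ≤-reflexive; +-identityʳ; *-zeroʳ; *-identityʳ)
open import Data.Nat.ListAction using (sum)
open import Data.Nat.Tactic.RingSolver using (solve-∀)
open import Data.List
  using (List; []; _∷_; length; map; concatMap; allFin; tails; cartesianProductWith)
open import Data.List.Properties using (length-++; length-map; length-removeAt′; map-cong)
open import Data.List.Relation.Unary.Any as Any using (here; there; _─_)
open import Data.List.Relation.Unary.All as All using (All)
open import Data.List.Relation.Unary.Unique.Propositional using (Unique)
open import Data.List.Relation.Unary.AllPairs using ([]; _∷_)
open import Data.List.Membership.Propositional using (_∈_)
open import Data.List.Membership.Propositional.Properties
  using (∈-map⁺; ∈-concatMap⁺; ∈-cartesianProductWith⁺; ∈-allFin)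
open import Data.List.Relation.Binary.Subset.Propositional using (_⊆_)
open import Data.Vec using (Vec; []; _∷_)
import Data.Vec.Relation.Unary.All as VecAll
open import Data.Vec.Relation.Unary.All.Properties using (lookup⁺)
open import Data.Product using (Σ; _,_; proj₂)
open import Data.Sum using (inj₁; inj₂)
open import Data.Unit using (⊤; tt)
open import Data.Empty using (⊥-elim)
open import Relation.Binary.PropositionalEquality
  using (_≡_; refl; sym; trans; cong; cong₂; _≢_; subst; module ≡-Reasoning)

module _ {A : Set} where

  ∈-─⁺ : ∀ {x z : A} (ys : List A) (x∈ys : x ∈ ys) → z ∈ ys → x ≢ z → z ∈ (ys ─ x∈ys)
  ∈-─⁺ (y ∷ ys) (here x≡y)  (here z≡y)  x≢z = ⊥-elim (x≢z (trans x≡y (sym z≡y)))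
  ∈-─⁺ (y ∷ ys) (here _)    (there z∈ys) _  = z∈ys
  ∈-─⁺ (y ∷ ys) (there _)   (here z≡y)  _   = here z≡y
  ∈-─⁺ (y ∷ ys) (there x∈ys) (there z∈ys) x≢z = there (∈-─⁺ ys x∈ys z∈ys x≢z)

  unique-⊆-length : ∀ {xs ys : List A} → Unique xs → xs ⊆ ys → length xs ≤ length ys
  unique-⊆-length {[]}     _ _ = z≤n
  unique-⊆-length {x ∷ xs} {ys} (x∉xs ∷ uniq) xs⊆ys =
    ≤-trans (s≤s (unique-⊆-length uniq rest⊆ys─x)) (≤-reflexive (sym (length-removeAt′ ys _)))
    where
      x∈ys : x ∈ ys
      x∈ys = xs⊆ys (here refl)
      rest⊆ys─x : xs ⊆ (ys ─ x∈ys)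
      rest⊆ys─x z∈xs = ∈-─⁺ ys x∈ys (xs⊆ys (there z∈xs)) (All.lookup x∉xs z∈xs)

module _ {A B C : Set} where

  length-cartesianProductWith : ∀ (f : A → B → C) (as : List A) (bs : List B) →
    length (cartesianProductWith f as bs) ≡ length as * length bs
  length-cartesianProductWith f []       bs = refl
  length-cartesianProductWith f (a ∷ as) bs =
    trans (length-++ (map (f a) bs))
          (cong₂ _+_ (length-map (f a) bs) (length-cartesianProductWith f as bs))

module _ {A B : Set} where

  length-concatMap : ∀ (f : A → List B) (as : List A) →
    length (concatMap f as) ≡ sum (map (length ∘ f) as)
  length-concatMap f []       = refl
  length-concatMap f (a ∷ as) = trans (length-++ (f a)) (cong (length (f a) +_) (length-concatMap f as))

module _ {A : Set} where

  vectorsOver : List A → (m : ℕ) → List (Vec A m)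
  vectorsOver as zero    = [] ∷ []
  vectorsOver as (suc m) = cartesianProductWith _∷_ as (vectorsOver as m)

  ∈-vectorsOver : ∀ {as : List A} {m} {v : Vec A m} → VecAll.All (_∈ as) v → v ∈ vectorsOver as m
  ∈-vectorsOver VecAll.[]         = here refl
  ∈-vectorsOver (a∈as VecAll.∷ w) = ∈-cartesianProductWith⁺ _∷_ a∈as (∈-vectorsOver w)

  length-vectorsOver : ∀ (as : List A) m → length (vectorsOver as m) ≡ length as ^ m
  length-vectorsOver as zero    = refl
  length-vectorsOver as (suc m) =
    trans (length-cartesianProductWith _∷_ as (vectorsOver as m))
          (cong (length as *_) (length-vectorsOver as m))

Polynomial : (ℕ → ℕ) → Set
Polynomial h = Σ (List ℕ) (λ π → ∀ n → evalPoly π n ≡ h n)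

module Coefficients where

  add : List ℕ → List ℕ → List ℕ
  add []       bs       = bs
  add (a ∷ as) []       = a ∷ as
  add (a ∷ as) (b ∷ bs) = a + b ∷ add as bs

  scale : ℕ → List ℕ → List ℕ
  scale c = map (c *_)

  mul : List ℕ → List ℕ → List ℕ
  mul []       bs = []
  mul (a ∷ as) bs = add (scale a bs) (0 ∷ mul as bs)

  eval-add : ∀ as bs n → evalPoly (add as bs) n ≡ evalPoly as n + evalPoly bs n
  eval-add []       bs       n = refl
  eval-add (a ∷ as) []       n = sym (+-identityʳ _)
  eval-add (a ∷ as) (b ∷ bs) n =
    trans (cong (λ t → a + b + n * t) (eval-add as bs n)) (interchange a b n (evalPoly as n) (evalPoly bs n))
    where
      interchange : ∀ a b n s t → a + b + n * (s + t) ≡ (a + n * s) + (b + n * t)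
      interchange = solve-∀

  eval-scale : ∀ c as n → evalPoly (scale c as) n ≡ c * evalPoly as n
  eval-scale c []       n = sym (*-zeroʳ c)
  eval-scale c (a ∷ as) n =
    trans (cong (λ t → c * a + n * t) (eval-scale c as n)) (factor c a n (evalPoly as n))
    where
      factor : ∀ c a n s → c * a + n * (c * s) ≡ c * (a + n * s)
      factor = solve-∀

  eval-mul : ∀ as bs n → evalPoly (mul as bs) n ≡ evalPoly as n * evalPoly bs n
  eval-mul []       bs n = refl
  eval-mul (a ∷ as) bs n = begin
    evalPoly (add (scale a bs) (0 ∷ mul as bs)) n
      ≡⟨ eval-add (scale a bs) (0 ∷ mul as bs) n ⟩
    evalPoly (scale a bs) n + n * evalPoly (mul as bs) n
      ≡⟨ cong₂ (λ s t → s + n * t) (eval-scale a bs n) (eval-mul as bs n) ⟩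
    a * evalPoly bs n + n * (evalPoly as n * evalPoly bs n)
      ≡⟨ distrib a n (evalPoly as n) (evalPoly bs n) ⟩
    (a + n * evalPoly as n) * evalPoly bs n
      ∎
    where
      open ≡-Reasoning
      distrib : ∀ a n s t → a * t + n * (s * t) ≡ (a + n * s) * t
      distrib = solve-∀

poly-const : ∀ c → Polynomial (λ _ → c)
poly-const c = c ∷ [] , λ n → trans (cong (c +_) (*-zeroʳ n)) (+-identityʳ c)

poly-id : Polynomial (λ n → n)
poly-id = 0 ∷ 1 ∷ [] , λ n → trans (cong (λ t → n * (1 + t)) (*-zeroʳ n)) (*-identityʳ n)

poly-+ : ∀ {g h} → Polynomial g → Polynomial h → Polynomial (λ n → g n + h n)
poly-+ (π , π≡g) (ϖ , ϖ≡h) =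
  Coefficients.add π ϖ , λ n → trans (Coefficients.eval-add π ϖ n) (cong₂ _+_ (π≡g n) (ϖ≡h n))

poly-* : ∀ {g h} → Polynomial g → Polynomial h → Polynomial (λ n → g n * h n)
poly-* (π , π≡g) (ϖ , ϖ≡h) =
  Coefficients.mul π ϖ , λ n → trans (Coefficients.eval-mul π ϖ n) (cong₂ _*_ (π≡g n) (ϖ≡h n))

poly-^ : ∀ {h} → Polynomial h → ∀ m → Polynomial (λ n → h n ^ m)
poly-^ P zero    = poly-const 1
poly-^ P (suc m) = poly-* P (poly-^ P m)

poly-sum : ∀ {I : Set} (is : List I) {h : I → ℕ → ℕ} →
  (∀ i → Polynomial (h i)) → Polynomial (λ n → sum (map (λ i → h i n) is))
poly-sum []       P = poly-const 0
poly-sum (i ∷ is) P = poly-+ (P i) (poly-sum is P)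

module _ {A : Set} where

  ∈-tails-self : ∀ (xs : List A) → xs ∈ tails xs
  ∈-tails-self xs = here refl

  ∈-tails-[] : ∀ (xs : List A) → [] ∈ tails xs
  ∈-tails-[] []       = here refl
  ∈-tails-[] (x ∷ xs) = there (∈-tails-[] xs)

  ∈-tails-tail : ∀ (xs : List A) {b bs} → (b ∷ bs) ∈ tails xs → bs ∈ tails xs
  ∈-tails-tail (x ∷ xs) (here refl) = there (∈-tails-self xs)
  ∈-tails-tail (x ∷ xs) (there m)   = there (∈-tails-tail xs m)

  length-tails : ∀ (xs : List A) → length (tails xs) ≡ suc (length xs)
  length-tails []       = refl
  length-tails (x ∷ xs) = cong suc (length-tails xs)

Admissible : List Bool → Val → Set
Admissible x (bit _) = ⊤
Admissible x (lst l) = l ∈ tails x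

admissibleValues : List Bool → List Val
admissibleValues x = bit true ∷ bit false ∷ map lst (tails x)

∈-admissibleValues : ∀ x {v} → Admissible x v → v ∈ admissibleValues x
∈-admissibleValues x {bit true}  _    = here refl
∈-admissibleValues x {bit false} _    = there (here refl)
∈-admissibleValues x {lst l}     l∈tx = there (there (∈-map⁺ lst l∈tx))

length-admissibleValues : ∀ x → length (admissibleValues x) ≡ 3 + length x
length-admissibleValues x = cong (suc ∘ suc) (trans (length-map lst (tails x)) (length-tails x))

-- The only operation that
-- creates a list is  tail, which maps suffixes of x to suffixes of x.
module Invariant (p : Program) (x : List Bool) where

  AdmissibleEnv : ∀ {m} → Env p m → Set
  AdmissibleEnv = VecAll.All (Admissible x)

  mutual
    eval-admissible : ∀ {m} {ρ : Env p m} {e v} → AdmissibleEnv ρ → Eval p ρ e v → Admissible x v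
    eval-admissible adm ev-true             = tt
    eval-admissible adm ev-false            = tt
    eval-admissible adm ev-nil              = ∈-tails-[] x
    eval-admissible adm (ev-var i)          = lookup⁺ adm i
    eval-admissible adm (ev-not _)          = tt
    eval-admissible adm (ev-null-nil _)     = tt
    eval-admissible adm (ev-null-cons _)    = tt
    eval-admissible adm (ev-head _)         = tt
    eval-admissible adm (ev-tail d)         = ∈-tails-tail x (eval-admissible adm d)
    eval-admissible adm (ev-if-true _ d)    = eval-admissible adm d
    eval-admissible adm (ev-if-false _ d)   = eval-admissible adm d
    eval-admissible adm (ev-call args body) = eval-admissible (args-admissible adm args) body

    args-admissible : ∀ {m} {ρ : Env p m} {j} {es : Vec (E p m) j} {vs} →
      AdmissibleEnv ρ → EvalArgs p ρ es vs → AdmissibleEnv vs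
    args-admissible adm ea-[]       = VecAll.[]
    args-admissible adm (ea-∷ d ds) = eval-admissible adm d VecAll.∷ args-admissible adm ds

  mutual
    calls-admissible : ∀ {m} {ρ : Env p m} {e c} → AdmissibleEnv ρ → Calls p ρ e c → AdmissibleEnv (proj₂ c)
    calls-admissible adm (c-not d)           = calls-admissible adm d
    calls-admissible adm (c-null d)          = calls-admissible adm d
    calls-admissible adm (c-head d)          = calls-admissible adm d
    calls-admissible adm (c-tail d)          = calls-admissible adm d
    calls-admissible adm (c-if0 d)           = calls-admissible adm d
    calls-admissible adm (c-if1 _ d)         = calls-admissible adm d
    calls-admissible adm (c-if2 _ d)         = calls-admissible adm d
    calls-admissible adm (c-args d)          = callsArgs-admissible adm d
    calls-admissible adm (c-call args)       = args-admissible adm args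
    calls-admissible adm (c-body args d)     = calls-admissible (args-admissible adm args) d

    callsArgs-admissible : ∀ {m} {ρ : Env p m} {j} {es : Vec (E p m) j} {c} →
      AdmissibleEnv ρ → CallsArgs p ρ es c → AdmissibleEnv (proj₂ c)
    callsArgs-admissible adm (ca-here d)    = calls-admissible adm d
    callsArgs-admissible adm (ca-there _ d) = callsArgs-admissible adm d

  reach-admissible : ∀ {c} → Reach p x c → AdmissibleEnv (proj₂ c)
  reach-admissible (inj₁ refl) = ∈-tails-self x VecAll.∷ VecAll.[]
  reach-admissible (inj₂ d)    = calls-admissible (∈-tails-self x VecAll.∷ VecAll.[]) d

module Candidates (p : Program) (x : List Bool) where

  -- Pairing as a non-dependent function, so that it can be mapped.
  call : (f : Fun p) → Env p (ar p f) → Call p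
  call f σ = f , σ

  values : List Val
  values = admissibleValues x

  callsOf : Fun p → List (Call p)
  callsOf f = map (call f) (vectorsOver values (ar p f))

  candidates : List (Call p)
  candidates = concatMap callsOf (allFin (suc (k p)))

  reach⊆candidates : ∀ {c} → Reach p x c → c ∈ candidates
  reach⊆candidates {f , σ} r = ∈-concatMap⁺ callsOf (Any.map (λ { refl → σ∈callsOf }) (∈-allFin f))
    where
      σ∈callsOf : (f , σ) ∈ callsOf f
      σ∈callsOf = ∈-map⁺ (call f) (∈-vectorsOver
        (VecAll.map (∈-admissibleValues x) (Invariant.reach-admissible p x r)))

  length-candidates : length candidates ≡ sum (map (λ f → (3 + length x) ^ ar p f) (allFin (suc (k p))))
  length-candidates =
    trans (length-concatMap callsOf (allFin (suc (k p))))
          (cong sum (map-cong length-callsOf (allFin (suc (k p)))))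
    where
      length-callsOf : ∀ f → length (callsOf f) ≡ (3 + length x) ^ ar p f
      length-callsOf f = begin
        length (callsOf f)                    ≡⟨ length-map (call f) (vectorsOver values (ar p f)) ⟩
        length (vectorsOver values (ar p f))  ≡⟨ length-vectorsOver values (ar p f) ⟩
        length values ^ ar p f                ≡⟨ cong (_^ ar p f) (length-admissibleValues x) ⟩
        (3 + length x) ^ ar p f               ∎
        where open ≡-Reasoning

reach-bound : (p : Program) (x : List Bool) →
  CardReach≤ p x (sum (map (λ f → (3 + length x) ^ ar p f) (allFin (suc (k p)))))
reach-bound p x cs unique reachable =
  ≤-trans (unique-⊆-length unique (reach⊆candidates ∘ All.lookup reachable))
          (≤-reflexive length-candidates)
  where open Candidates p x

reachBound-polynomial : (p : Program) →
  Polynomial (λ n → sum (map (λ f → (3 + n) ^ ar p f) (allFin (suc (k p)))))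
reachBound-polynomial p =
  poly-sum (allFin (suc (k p))) (λ f → poly-^ (poly-+ (poly-const 3) poly-id) (ar p f))

lemma3 : (p : Program) → Σ (List ℕ) (λ π → (x : List Bool) → CardReach≤ p x (evalPoly π (length x)))
lemma3 p with reachBound-polynomial p
... | π , π≡bound = π , λ x cs unique reachable →
  subst (length cs ≤_) (sym (π≡bound (length x))) (reach-bound p x cs unique reachable)
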